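{- Let $a\geq 2$ be an integer. Then $$a^{2a-2}\geq \frac{P_a(2a-1)\cdot\bigl(P_a(2a-1)+1\bigr)}{2}.$$
   Context: For positive integers $k,m$, $P_k(m)$ denotes the number of integer partitions of $m$ into exactly $k$ (positive) parts. -}

module Defs where

open import Data.Nat using (ℕ; zero; suc; _+_; _∸_; _≤?_)
open import Relation.Nullary using (yes; no)

-- parts k m b : number of partitions of m into exactly k positive parts,
-- each part ≤ b.  Enumerated by choosing the largest part j (1 ≤ j ≤ b),
-- then partitioning m ∸ j into k-1 parts each ≤ j.
-- sumTo j f = f 1 + f 2 + ... + f j
sumTo : ℕ → (ℕ → ℕ) → ℕ
sumTo zero    f = 0
sumTo (suc j) f = sumTo j f + f (suc j)

parts : ℕ → ℕ → ℕ → ℕ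
parts zero    zero    b = 1
parts zero    (suc m) b = 0
parts (suc k) m       b =
  sumTo b (λ j → count j)
  where
  count : ℕ → ℕ
  count j with j ≤? m
  ... | yes _ = parts k (m ∸ j) j
  ... | no  _ = 0

P : ℕ → ℕ → ℕ
P k m = parts k m m

{-# OPTIONS --safe #-}
-- Counting partitions of m into k + 1 parts by their largest part j, which
-- ranges over 1 ≤ j ≤ m ∸ k, and bounding the partitions of the remainder
-- inductively (a single part admits only j = m) gives P (k + 1) m ≤ (m ∸ k) ^ k.
-- For a = k + 1 and m = 2a − 1 this is P ≤ a ^ (a − 1), whence
-- P (P + 1) / 2 ≤ (a ^ (a − 1)) ^ 2 = a ^ (2a − 2).
module Submission where

open import Defs
open import Data.Nat using (ℕ; zero; suc; _≤_; _<_; _*_; _+_; _∸_; _^_; _/_; _≤?_; z≤n; s≤s; z<s; s≤s⁻¹)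
open import Data.Nat.Properties
open import Data.Nat.DivMod using (/-monoˡ-≤; m*n/n≡m)
open import Data.Product using (_,_)
open import Relation.Nullary using (yes; no; ¬_)
open import Relation.Nullary.Negation using (contradiction)
open import Relation.Binary.PropositionalEquality

partsWithLargest : ℕ → ℕ → ℕ → ℕ
partsWithLargest k m j with j ≤? m
... | yes _ = parts k (m ∸ j) j
... | no  _ = 0

parts-suc : ∀ k m b →
  parts (suc k) m (suc b) ≡ parts (suc k) m b + partsWithLargest k m (suc b)
parts-suc k m b with suc b ≤? m
... | yes _ = refl
... | no  _ = refl

j≤m⇒partsWithLargest≡parts : ∀ k {m j} → j ≤ m → partsWithLargest k m j ≡ parts k (m ∸ j) j
j≤m⇒partsWithLargest≡parts k {m} {j} j≤m with j ≤? m
... | yes _  = refl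
... | no j≰m = contradiction j≤m j≰m

j≰m⇒partsWithLargest≡0 : ∀ k {m j} → ¬ j ≤ m → partsWithLargest k m j ≡ 0
j≰m⇒partsWithLargest≡0 k {m} {j} j≰m with j ≤? m
... | yes j≤m = contradiction j≤m j≰m
... | no  _   = refl

m<k⇒parts≡0 : ∀ k m b → m < k → parts k m b ≡ 0
m<k⇒parts≡0 (suc k) m zero    m<k = refl
m<k⇒parts≡0 (suc k) m (suc b) m<k = begin
  parts (suc k) m (suc b)                                ≡⟨ parts-suc k m b ⟩
  parts (suc k) m b + partsWithLargest k m (suc b)       ≡⟨ cong₂ _+_ (m<k⇒parts≡0 (suc k) m b m<k) largest≡0 ⟩
  0                                                      ∎
  where
  open ≡-Reasoning
  largest≡0 : partsWithLargest k m (suc b) ≡ 0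
  largest≡0 with suc b ≤? m
  ... | yes b<m = m<k⇒parts≡0 k (m ∸ suc b) (suc b)
                    (<-≤-trans (∸-monoʳ-< {m} {suc b} {0} z<s b<m) (s≤s⁻¹ m<k))
  ... | no  _   = refl

-- A largest part j > m ∸ k leaves fewer than k for the other k parts.
partsWithLargest≡0 : ∀ k m j → m ∸ k ≤ j → partsWithLargest k m (suc j) ≡ 0
partsWithLargest≡0 k m j m∸k≤j with suc j ≤? m
... | no  _   = refl
... | yes j<m = m<k⇒parts≡0 k (m ∸ suc j) (suc j) (begin-strict
  m ∸ suc j               <⟨ ∸-monoˡ-< m<k+suc[j] j<m ⟩
  k + suc j ∸ suc j       ≡⟨ m+n∸n≡m k (suc j) ⟩
  k                       ∎)
  where
  open ≤-Reasoning
  m<k+suc[j] : m < k + suc j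
  m<k+suc[j] = begin-strict
    m                     ≤⟨ m≤n+m∸n m k ⟩
    k + (m ∸ k)           ≤⟨ +-monoʳ-≤ k m∸k≤j ⟩
    k + j                 <⟨ +-monoʳ-< k (n<1+n j) ⟩
    k + suc j             ∎

parts₀≤1 : ∀ n b → parts 0 n b ≤ 1
parts₀≤1 zero    b = ≤-refl
parts₀≤1 (suc n) b = z≤n

0<n⇒parts₀≡0 : ∀ {n} b → 0 < n → parts 0 n b ≡ 0
0<n⇒parts₀≡0 {suc n} b _ = refl

partsWithLargest₀≤1 : ∀ m j → partsWithLargest 0 m j ≤ 1
partsWithLargest₀≤1 m j with j ≤? m
... | yes _ = parts₀≤1 (m ∸ j) j
... | no  _ = z≤n

b<m⇒parts₁≡0 : ∀ m b → b < m → parts 1 m b ≡ 0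
b<m⇒parts₁≡0 m zero    b<m = refl
b<m⇒parts₁≡0 m (suc b) b<m = begin
  parts 1 m (suc b)                                  ≡⟨ parts-suc 0 m b ⟩
  parts 1 m b + partsWithLargest 0 m (suc b)         ≡⟨ cong₂ _+_ (b<m⇒parts₁≡0 m b (<-trans (n<1+n b) b<m)) largest≡0 ⟩
  0                                                  ∎
  where
  open ≡-Reasoning
  largest≡0 : partsWithLargest 0 m (suc b) ≡ 0
  largest≡0 = trans (j≤m⇒partsWithLargest≡parts 0 (<⇒≤ b<m)) (0<n⇒parts₀≡0 (suc b) (m<n⇒0<n∸m b<m))

parts₁≤1 : ∀ m b → parts 1 m b ≤ 1
parts₁≤1 m zero    = z≤n
parts₁≤1 m (suc b) with m ≤? b
... | yes m≤b = begin
  parts 1 m (suc b)                                  ≡⟨ parts-suc 0 m b ⟩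
  parts 1 m b + partsWithLargest 0 m (suc b)         ≡⟨ cong (parts 1 m b +_) (j≰m⇒partsWithLargest≡0 0 (<⇒≱ (s≤s m≤b))) ⟩
  parts 1 m b + 0                                    ≡⟨ +-identityʳ _ ⟩
  parts 1 m b                                        ≤⟨ parts₁≤1 m b ⟩
  1                                                  ∎
  where open ≤-Reasoning
... | no  m≰b = begin
  parts 1 m (suc b)                                  ≡⟨ parts-suc 0 m b ⟩
  parts 1 m b + partsWithLargest 0 m (suc b)         ≡⟨ cong (_+ partsWithLargest 0 m (suc b)) (b<m⇒parts₁≡0 m b (≰⇒> m≰b)) ⟩
  partsWithLargest 0 m (suc b)                       ≤⟨ partsWithLargest₀≤1 m (suc b) ⟩
  1                                                  ∎
  where open ≤-Reasoning

parts≤b*bound : ∀ k m B → (∀ j → partsWithLargest k m (suc j) ≤ B) →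
  ∀ b → parts (suc k) m b ≤ b * B
parts≤b*bound k m B bounded zero    = z≤n
parts≤b*bound k m B bounded (suc b) = begin
  parts (suc k) m (suc b)                            ≡⟨ parts-suc k m b ⟩
  parts (suc k) m b + partsWithLargest k m (suc b)   ≤⟨ +-mono-≤ (parts≤b*bound k m B bounded b) (bounded b) ⟩
  b * B + B                                          ≡⟨ +-comm (b * B) B ⟩
  suc b * B                                          ∎
  where open ≤-Reasoning

parts-stable : ∀ k m b → m ∸ k ≤ b → parts (suc k) m b ≡ parts (suc k) m (m ∸ k)
parts-stable k m b m∸k≤b with m≤n⇒∃[o]m+o≡n m∸k≤b
... | o , refl = stable o
  where
  open ≡-Reasoning
  stable : ∀ o → parts (suc k) m (m ∸ k + o) ≡ parts (suc k) m (m ∸ k)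
  stable zero    = cong (parts (suc k) m) (+-identityʳ (m ∸ k))
  stable (suc o) = begin
    parts (suc k) m (m ∸ k + suc o)                                    ≡⟨ cong (parts (suc k) m) (+-suc (m ∸ k) o) ⟩
    parts (suc k) m (suc (m ∸ k + o))                                  ≡⟨ parts-suc k m (m ∸ k + o) ⟩
    parts (suc k) m (m ∸ k + o) + partsWithLargest k m (suc (m ∸ k + o)) ≡⟨ cong₂ _+_ (stable o) (partsWithLargest≡0 k m (m ∸ k + o) (m≤m+n (m ∸ k) o)) ⟩
    parts (suc k) m (m ∸ k) + 0                                        ≡⟨ +-identityʳ _ ⟩
    parts (suc k) m (m ∸ k)                                            ∎

parts≤[m∸k]*bound : ∀ k m B → (∀ j → partsWithLargest k m (suc j) ≤ B) →
  ∀ b → parts (suc k) m b ≤ (m ∸ k) * B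
parts≤[m∸k]*bound k m B bounded b with b ≤? m ∸ k
... | yes b≤m∸k = ≤-trans (parts≤b*bound k m B bounded b) (*-monoˡ-≤ B b≤m∸k)
... | no  b≰m∸k = ≤-trans (≤-reflexive (parts-stable k m b (<⇒≤ (≰⇒> b≰m∸k))))
                          (parts≤b*bound k m B bounded (m ∸ k))

parts≤[m∸k]^k : ∀ k m b → parts (suc k) m b ≤ (m ∸ k) ^ k
parts≤[m∸k]^k zero    m b = parts₁≤1 m b
parts≤[m∸k]^k (suc k) m b = parts≤[m∸k]*bound (suc k) m ((m ∸ suc k) ^ k) largest≤ b
  where
  open ≤-Reasoning
  largest≤ : ∀ j → partsWithLargest (suc k) m (suc j) ≤ (m ∸ suc k) ^ k
  largest≤ j with suc j ≤? m
  ... | no  _ = z≤n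
  ... | yes _ = begin
    parts (suc k) (m ∸ suc j) (suc j)    ≤⟨ parts≤[m∸k]^k k (m ∸ suc j) (suc j) ⟩
    (m ∸ suc j ∸ k) ^ k                  ≡⟨ cong (_^ k) (∸-+-assoc m (suc j) k) ⟩
    (m ∸ (suc j + k)) ^ k                ≤⟨ ^-monoˡ-≤ k (∸-monoʳ-≤ m (s≤s (m≤n+m k j))) ⟩
    (m ∸ suc k) ^ k                      ∎

P[1+k,2k+1]≤[1+k]^k : ∀ k → P (suc k) (2 * suc k ∸ 1) ≤ suc k ^ k
P[1+k,2k+1]≤[1+k]^k k = subst (λ n → P (suc k) (2 * suc k ∸ 1) ≤ n ^ k) 2[1+k]∸1∸k≡1+k
  (parts≤[m∸k]^k k (2 * suc k ∸ 1) (2 * suc k ∸ 1))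
  where
  2[1+k]∸1∸k≡1+k : 2 * suc k ∸ 1 ∸ k ≡ suc k
  2[1+k]∸1∸k≡1+k = trans (cong (λ n → k + suc n ∸ k) (+-identityʳ k)) (m+n∸m≡n k (suc k))

triangular : ℕ → ℕ
triangular n = n * (n + 1) / 2

triangular-mono-≤ : ∀ {m n} → m ≤ n → triangular m ≤ triangular n
triangular-mono-≤ m≤n = /-monoˡ-≤ 2 (*-mono-≤ m≤n (+-monoˡ-≤ 1 m≤n))

triangular≤square : ∀ n → triangular n ≤ n * n
triangular≤square zero    = z≤n
triangular≤square n@(suc _) = begin
  n * (n + 1) / 2          ≤⟨ /-monoˡ-≤ 2 (*-monoʳ-≤ n n+1≤n*2) ⟩
  n * (n * 2) / 2          ≡⟨ cong (_/ 2) (sym (*-assoc n n 2)) ⟩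
  n * n * 2 / 2            ≡⟨ m*n/n≡m (n * n) 2 ⟩
  n * n                    ∎
  where
  open ≤-Reasoning
  n+1≤n*2 : n + 1 ≤ n * 2
  n+1≤n*2 = begin
    n + 1                  ≤⟨ +-monoʳ-≤ n (s≤s z≤n) ⟩
    n + n                  ≡⟨ cong (n +_) (sym (+-identityʳ n)) ⟩
    2 * n                  ≡⟨ *-comm 2 n ⟩
    n * 2                  ∎

corollary2p4p1 : (a : ℕ) → 2 ≤ a →
    (P a (2 * a ∸ 1) * (P a (2 * a ∸ 1) + 1)) / 2 ≤ a ^ (2 * a ∸ 2)
corollary2p4p1 zero      _ = ≤-refl
corollary2p4p1 a@(suc k) _ = begin
  triangular (P a (2 * a ∸ 1))    ≤⟨ triangular-mono-≤ (P[1+k,2k+1]≤[1+k]^k k) ⟩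
  triangular (a ^ k)              ≤⟨ triangular≤square (a ^ k) ⟩
  a ^ k * a ^ k                   ≡⟨ sym (^-distribˡ-+-* a k k) ⟩
  a ^ (k + k)                     ≡⟨ cong (a ^_) (sym 2[1+k]∸2≡k+k) ⟩
  a ^ (2 * a ∸ 2)                 ∎
  where
  open ≤-Reasoning
  2[1+k]∸2≡k+k : 2 * a ∸ 2 ≡ k + k
  2[1+k]∸2≡k+k = trans (cong (_∸ 1) (+-suc k (k + 0))) (cong (k +_) (+-identityʳ k))
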